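{- Let $G=(V,E)$ be an undirected weighted graph, $T\subseteq V$ a terminal set, $S\subseteq T$, and $\delta,\kappa>0$. Let $G'$ be obtained from $G$ by adding a source $\sigma$ with an edge of capacity $\delta\kappa$ to each terminal in $S$, and a sink $\tau$ with an edge of capacity $\delta\kappa$ from each terminal in $T\setminus S$ (edges of $G$ keep their weights as capacities). Let $(U',\overline{U'})$ be a minimum $\sigma$–$\tau$ cut in $G'$ with $\sigma\in U'$, and set $U=U'\setminus\{\sigma\}$, $\overline U=\overline{U'}\setminus\{\tau\}$. If $|S|\ge|T|/3$, $|T\setminus S|\ge |T|/3$, and the maximum $\sigma$–$\tau$ flow in $G'$ has value less than $|T|/6\cdot\delta\cdot\kappa$, then $|U|\ge|T|/6$ and $|\overline U|\ge|T|/6$.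
   Formalization: The edge weights of G and the parameters δ and κ take values in the rationals. -}

module Defs where

open import Data.Nat using (ℕ)
open import Data.Bool using (Bool; true; false; if_then_else_; not)
open import Data.Fin using (Fin)
open import Data.Fin.Subset using (Subset; _─_)
open import Data.List using (List; []; _∷_; map; foldr; allFin; _++_)
open import Data.Vec using (lookup)
open import Data.Rational using (ℚ; 0ℚ; _+_; _*_; -_; _≤_; _<_)
open import Relation.Binary.PropositionalEquality using (_≡_)

data Vert (n : ℕ) : Set where
  σ   : Vert n
  τ   : Vert n
  old : Fin n → Vert n

allVert : (n : ℕ) → List (Vert n)
allVert n = σ ∷ τ ∷ map old (allFin n)

Σℚ : {A : Set} → List A → (A → ℚ) → ℚ
Σℚ xs f = foldr (λ x acc → f x + acc) 0ℚ xs

-- an undirected weighted graph on vertex set Fin n: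
-- symmetric nonnegative weight function (weight 0 = no edge)
record WGraph (n : ℕ) : Set where
  field
    w     : Fin n → Fin n → ℚ
    w-sym : ∀ i j → w i j ≡ w j i
    w-nn  : ∀ i j → 0ℚ ≤ w i j

_on_at_ : ℚ → {n : ℕ} → Subset n → Fin n → ℚ
q on A at i = if lookup A i then q else 0ℚ

-- capacities of G' (undirected: symmetric).  Edges of G keep their weights,
-- σ is joined to each terminal of S, τ to each terminal of T ∖ S,
-- each with capacity δκ  (here dk = δ * κ).
cap' : {n : ℕ} → WGraph n → (T S : Subset n) → (dk : ℚ) → Vert n → Vert n → ℚ
cap' G T S dk σ       (old i) = dk on S at i
cap' G T S dk (old i) σ       = dk on S at i
cap' G T S dk τ       (old i) = dk on (T ─ S) at i
cap' G T S dk (old i) τ       = dk on (T ─ S) at i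
cap' G T S dk (old i) (old j) = WGraph.w G i j
cap' G T S dk _       _       = 0ℚ

-- a σ–τ flow in a network with capacity c (undirected edges: flows are
-- skew-symmetric and bounded by the capacity in each direction)
record IsFlow {n : ℕ} (c : Vert n → Vert n → ℚ) (f : Vert n → Vert n → ℚ) : Set where
  field
    skew         : ∀ u v → f u v ≡ - f v u
    capacity     : ∀ u v → f u v ≤ c u v
    conservation : ∀ i → Σℚ (allVert n) (λ v → f (old i) v) ≡ 0ℚ

flowValue : {n : ℕ} → (Vert n → Vert n → ℚ) → ℚ
flowValue {n} f = Σℚ (allVert n) (λ v → f σ v)

record IsMaxFlow {n : ℕ} (c : Vert n → Vert n → ℚ) (f : Vert n → Vert n → ℚ) : Set where
  field
    isFlow  : IsFlow c f
    maximal : ∀ g → IsFlow c g → flowValue g ≤ flowValue f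

-- σ–τ cuts (U', complement) with σ ∈ U', τ ∉ U' are given by U = U' ∖ {σ} ⊆ V
inSide : {n : ℕ} → Subset n → Vert n → Bool
inSide U σ       = true
inSide U τ       = false
inSide U (old i) = lookup U i

cutCapacity : {n : ℕ} → (Vert n → Vert n → ℚ) → Subset n → ℚ
cutCapacity {n} c U =
  Σℚ (allVert n) (λ u → Σℚ (allVert n) (λ v →
    if inSide U u then (if inSide U v then 0ℚ else c u v) else 0ℚ))

IsMinCut : {n : ℕ} → (Vert n → Vert n → ℚ) → Subset n → Set
IsMinCut c U = ∀ W → cutCapacity c U ≤ cutCapacity c W

{-# OPTIONS --safe #-}
module Submission where

-- The bound needs the nontrivial half of max-flow/min-cut duality: some flow has value
-- equal to the capacity of some cut, so a minimum cut U has capacity at most the maximum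
-- flow value, i.e. less than |T|·δκ/6.  That flow is produced by augmenting paths after
-- scaling all capacities to natural multiples of 1/D, D a common denominator, so that the
-- residual capacity leaving σ strictly decreases.  A σ–τ cut pays δκ for every terminal of
-- S outside U and for every terminal of T ∖ S inside U; hence fewer than |T|/6 terminals of S
-- lie outside U, and |S| ≥ |T|/3 leaves more than |T|/6 of them inside U.  The same argument
-- with T ∖ S gives the bound for the complement of U.

open import Defs
open import Data.Bool as Bool using (Bool; true; false; if_then_else_; _∨_)
open import Data.Fin as Fin using (Fin; zero; suc; punchIn)
open import Data.Fin.Subset using (Subset; _⊆_; _─_; ∣_∣; ∁)
open import Data.Nat using (ℕ)
open import Data.Product using (∃; _×_; _,_; proj₁; proj₂)
open import Data.Vec as Vec using ([]; _∷_; lookup)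
open import Function using (id; _∘_; _↔_; Inverse; mk↔ₛ′)
open import Relation.Binary.PropositionalEquality

module FiniteSums where

  open import Data.Fin.Properties using (punchInᵢ≢i)
  open import Data.Nat as ℕ using (zero; suc; _+_; _*_; _≤_; z≤n)
  open import Data.Nat.Divisibility using (_∣_; m∣m*n)
  import Data.Nat.Properties as ℕ
  open import Algebra.Properties.CommutativeMonoid.Sum ℕ.+-0-commutativeMonoid
    using (sum; sum-syntax; sum-cong-≗; sum-remove)
  open import Algebra.Properties.CommutativeMonoid.Sum ℕ.*-1-commutativeMonoid
    using () renaming (sum to ∏; sum-remove to ∏-remove)
  open import Algebra.Properties.CommutativeSemigroup ℕ.+-commutativeSemigroup
    using (xy∙z≈zy∙x)
  open ≡-Reasoning

  entry≤sum : ∀ {N} (f : Fin N → ℕ) i → f i ≤ sum f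
  entry≤sum {suc N} f i = ℕ.≤-trans (ℕ.m≤m+n (f i) _) (ℕ.≤-reflexive (sym (sum-remove {i = i} f)))

  sum-mono-≤ : ∀ {N} {f g : Fin N → ℕ} → (∀ i → f i ≤ g i) → sum f ≤ sum g
  sum-mono-≤ {zero}  f≤g = z≤n
  sum-mono-≤ {suc N} f≤g = ℕ.+-mono-≤ (f≤g zero) (sum-mono-≤ (f≤g ∘ suc))

  sum-agree-except : ∀ {N} (f g : Fin N → ℕ) i → (∀ j → j ≢ i → f j ≡ g j) →
                     sum f + g i ≡ sum g + f i
  sum-agree-except {suc N} f g i f≡g = begin
    sum f + g i                      ≡⟨ cong (_+ g i) (sum-remove {i = i} f) ⟩
    f i + sum (f ∘ punchIn i) + g i  ≡⟨ cong (λ x → f i + x + g i) (sum-cong-≗ f≡g-off-i) ⟩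
    f i + sum (g ∘ punchIn i) + g i  ≡⟨ xy∙z≈zy∙x (f i) _ (g i) ⟩
    g i + sum (g ∘ punchIn i) + f i  ≡⟨ cong (_+ f i) (sum-remove {i = i} g) ⟨
    sum g + f i                      ∎
    where
    f≡g-off-i : ∀ j → f (punchIn i j) ≡ g (punchIn i j)
    f≡g-off-i j = f≡g _ (punchInᵢ≢i i j)

  ∏-divisible : ∀ {N} (f : Fin N → ℕ) i → f i ∣ ∏ f
  ∏-divisible {suc N} f i = subst (f i ∣_) (sym (∏-remove {i = i} f)) (m∣m*n _)

  ∏-nonZero : ∀ {N} (f : Fin N → ℕ) → (∀ i → ℕ.NonZero (f i)) → ℕ.NonZero (∏ f)
  ∏-nonZero {zero}  f f≢0 = _
  ∏-nonZero {suc N} f f≢0 =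
    ℕ.m*n≢0 (f zero) _ {{f≢0 zero}} {{∏-nonZero (f ∘ suc) (f≢0 ∘ suc)}}

  ∑-outside : ∀ {n} k (P Q : Subset n) →
              ∑[ i < n ] (if lookup Q i then 0 else (if lookup P i then k else 0)) ≡ ∣ P ─ Q ∣ * k
  ∑-outside k []          []          = refl
  ∑-outside k (_     ∷ P) (true  ∷ Q) = ∑-outside k P Q
  ∑-outside k (true  ∷ P) (false ∷ Q) = cong (k +_) (∑-outside k P Q)
  ∑-outside k (false ∷ P) (false ∷ Q) = ∑-outside k P Q

  ∑-inside : ∀ {n} k (P Q : Subset n) →
             ∑[ i < n ] (if lookup Q i then (if lookup P i then k else 0) else 0) ≡ ∣ P ─ ∁ Q ∣ * k
  ∑-inside k []          []          = refl
  ∑-inside k (true  ∷ P) (true  ∷ Q) = cong (k +_) (∑-inside k P Q)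
  ∑-inside k (false ∷ P) (true  ∷ Q) = ∑-inside k P Q
  ∑-inside k (_     ∷ P) (false ∷ Q) = ∑-inside k P Q

module SideSizes where

  open import Data.Nat as ℕ using (_+_; _*_; _≤_; _<_; z≤n; s≤s)
  import Data.Nat.Properties as ℕ
  open ℕ.≤-Reasoning

  ∣p∣≤∣p─q∣+∣q∣ : ∀ {n} (p q : Subset n) → ∣ p ∣ ≤ ∣ p ─ q ∣ + ∣ q ∣
  ∣p∣≤∣p─q∣+∣q∣ []          []          = z≤n
  ∣p∣≤∣p─q∣+∣q∣ (true  ∷ p) (true  ∷ q) =
    ℕ.≤-trans (s≤s (∣p∣≤∣p─q∣+∣q∣ p q)) (ℕ.≤-reflexive (sym (ℕ.+-suc _ _)))
  ∣p∣≤∣p─q∣+∣q∣ (false ∷ p) (true  ∷ q) = ℕ.≤-trans (∣p∣≤∣p─q∣+∣q∣ p q) (ℕ.+-monoʳ-≤ _ (ℕ.n≤1+n _))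
  ∣p∣≤∣p─q∣+∣q∣ (true  ∷ p) (false ∷ q) = s≤s (∣p∣≤∣p─q∣+∣q∣ p q)
  ∣p∣≤∣p─q∣+∣q∣ (false ∷ p) (false ∷ q) = ∣p∣≤∣p─q∣+∣q∣ p q

  sixth-bound : ∀ {t p a u} → t ≤ 3 * p → p ≤ a + u → 6 * a < t → t ≤ 6 * u
  sixth-bound {t} {p} {a} {u} t≤3p p≤a+u 6a<t = ℕ.<⇒≤ (ℕ.+-cancelˡ-< t t (6 * u) (begin-strict
    t + t          ≤⟨ ℕ.+-mono-≤ t≤3p t≤3p ⟩
    3 * p + 3 * p  ≡⟨ ℕ.*-distribʳ-+ p 3 3 ⟨
    6 * p          ≤⟨ ℕ.*-monoʳ-≤ 6 p≤a+u ⟩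
    6 * (a + u)    ≡⟨ ℕ.*-distribˡ-+ 6 a u ⟩
    6 * a + 6 * u  <⟨ ℕ.+-monoˡ-< (6 * u) 6a<t ⟩
    t + 6 * u      ∎))

  *-bound-cancel : ∀ {p k c d t} → p * k ≤ c → d * c < t * k → d * p < t
  *-bound-cancel {p} {k} {c} {d} {t} pk≤c dc<tk = ℕ.*-cancelʳ-< k (d * p) t (begin-strict
    d * p * k    ≡⟨ ℕ.*-assoc d p k ⟩
    d * (p * k)  ≤⟨ ℕ.*-monoʳ-≤ d pk≤c ⟩
    d * c        <⟨ dc<tk ⟩
    t * k        ∎)

  large-side : ∀ {n t k c} (P Q : Subset n) →
               t ≤ 3 * ∣ P ∣ → ∣ P ─ Q ∣ * k ≤ c → 6 * c < t * k → t ≤ 6 * ∣ Q ∣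
  large-side P Q t≤3P [P─Q]k≤c 6c<tk =
    sixth-bound {p = ∣ P ∣} {a = ∣ P ─ Q ∣} {u = ∣ Q ∣} t≤3P (∣p∣≤∣p─q∣+∣q∣ P Q)
      (*-bound-cancel {p = ∣ P ─ Q ∣} {d = 6} [P─Q]k≤c 6c<tk)

module ResidualNetworks {V : Set} {N : ℕ} (enum : Fin N ↔ V) (s t : V) (s≢t : s ≢ t) where

  open import Data.Bool.Properties using (∨-zeroʳ; ∨-identityʳ)
  open import Data.Fin.Properties using (any?)
  open import Data.Nat as ℕ using (zero; suc; pred; _+_; _≤_; _<_; _<?_)
  open import Data.Nat.Induction using (<-wellFounded)
  import Data.Nat.Properties as ℕ
  open import Induction.WellFounded using (Acc; acc)
  open import Relation.Binary.Definitions using (DecidableEquality)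
  open import Relation.Nullary using (Dec; yes; no; ¬_; does)
  open import Relation.Nullary.Decidable using (map′; _×-dec_; dec-true; dec-false)
  open import Relation.Nullary.Negation using (contradiction)
  open import Algebra.Properties.CommutativeMonoid.Sum ℕ.+-0-commutativeMonoid
    using (sum-syntax; sum-cong-≗; sum-replicate-zero; ∑-distrib-+; ∑-comm)
  open import Algebra.Properties.CommutativeSemigroup ℕ.+-commutativeSemigroup
    using (x∙yz≈y∙xz; xy∙z≈xz∙y)
  open FiniteSums using (entry≤sum; sum-mono-≤; sum-agree-except)
  open Inverse enum using (to; from; strictlyInverseˡ; strictlyInverseʳ)
  open ≡-Reasoning

  private
    pred-+-suc : ∀ {a} b → 0 < a → pred a + suc b ≡ a + b
    pred-+-suc {suc a} b _ = ℕ.+-suc a b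

    +-suc-cancel : ∀ a b k → a + suc k ≡ b + k → a + 1 ≡ b + 0
    +-suc-cancel a b k eq = ℕ.+-cancelʳ-≡ k (a + 1) (b + 0) (begin
      a + 1 + k  ≡⟨ ℕ.+-assoc a 1 k ⟩
      a + suc k  ≡⟨ eq ⟩
      b + k      ≡⟨ cong (_+ k) (ℕ.+-identityʳ b) ⟨
      b + 0 + k  ∎)

    +-telescope : ∀ a b c {i j k} → a + i ≡ b + j → b + k ≡ c + i → a + k ≡ c + j
    +-telescope a b c {i} {j} {k} a+i≡b+j b+k≡c+i = ℕ.+-cancelʳ-≡ i _ _ (begin
      a + k + i  ≡⟨ xy∙z≈xz∙y a k i ⟩
      a + i + k  ≡⟨ cong (_+ k) a+i≡b+j ⟩
      b + j + k  ≡⟨ xy∙z≈xz∙y b j k ⟩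
      b + k + j  ≡⟨ cong (_+ j) b+k≡c+i ⟩
      c + i + j  ≡⟨ xy∙z≈xz∙y c i j ⟩
      c + j + i  ∎)

  _≟_ : DecidableEquality V
  u ≟ v with from u Fin.≟ from v
  ... | yes e = yes (trans (sym (strictlyInverseˡ u)) (trans (cong to e) (strictlyInverseˡ v)))
  ... | no ¬e = no (¬e ∘ cong from)

  ∃? : {P : V → Set} → (∀ v → Dec (P v)) → Dec (∃ P)
  ∃? {P} P? = map′ (λ (i , p) → to i , p)
                   (λ (v , p) → from v , subst P (sym (strictlyInverseˡ v)) p)
                   (any? (P? ∘ to))

  ΣV : (V → ℕ) → ℕ
  ΣV f = ∑[ i < N ] f (to i)

  ΣV-cong : {f g : V → ℕ} → (∀ v → f v ≡ g v) → ΣV f ≡ ΣV g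
  ΣV-cong f≡g = sum-cong-≗ (f≡g ∘ to)

  ΣV-zero : ΣV (λ _ → 0) ≡ 0
  ΣV-zero = sum-replicate-zero N

  ΣV-distrib-+ : (f g : V → ℕ) → ΣV (λ v → f v + g v) ≡ ΣV f + ΣV g
  ΣV-distrib-+ f g = ∑-distrib-+ (f ∘ to) (g ∘ to)

  ΣV-comm : (f : V → V → ℕ) → ΣV (λ u → ΣV (λ v → f u v)) ≡ ΣV (λ v → ΣV (λ u → f u v))
  ΣV-comm f = ∑-comm (λ i j → f (to i) (to j))

  ΣV-mono-≤ : {f g : V → ℕ} → (∀ v → f v ≤ g v) → ΣV f ≤ ΣV g
  ΣV-mono-≤ f≤g = sum-mono-≤ (f≤g ∘ to)

  entry≤ΣV : (f : V → ℕ) (v : V) → f v ≤ ΣV f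
  entry≤ΣV f v = subst (_≤ ΣV f) (cong f (strictlyInverseˡ v)) (entry≤sum (f ∘ to) (from v))

  ΣV-agree-except : (f g : V → ℕ) (p : V) → (∀ v → v ≢ p → f v ≡ g v) →
                    ΣV f + g p ≡ ΣV g + f p
  ΣV-agree-except f g p f≡g = subst (λ q → ΣV f + g q ≡ ΣV g + f q) (strictlyInverseˡ p)
    (sum-agree-except (f ∘ to) (g ∘ to) (from p)
      (λ j j≢ → f≡g (to j) (λ e → j≢ (trans (sym (strictlyInverseʳ j)) (cong from e)))))

  𝟙[_≡_] : V → V → ℕ
  𝟙[ u ≡ v ] = if does (u ≟ v) then 1 else 0

  𝟙-refl : ∀ u → 𝟙[ u ≡ u ] ≡ 1
  𝟙-refl u rewrite dec-true (u ≟ u) refl = refl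

  𝟙-≢ : ∀ {u v} → u ≢ v → 𝟙[ u ≡ v ] ≡ 0
  𝟙-≢ {u} {v} u≢v rewrite dec-false (u ≟ v) u≢v = refl

  Matrix : Set
  Matrix = V → V → ℕ

  row : Matrix → V → ℕ
  row m u = ΣV (m u)

  push : Matrix → V → V → Matrix
  push m x y u v =
    if does ((u ≟ x) ×-dec (v ≟ y)) then pred (m u v)
    else if does ((u ≟ y) ×-dec (v ≟ x)) then suc (m u v)
    else m u v

  push-forward : ∀ m x y → push m x y x y ≡ pred (m x y)
  push-forward m x y rewrite dec-true ((x ≟ x) ×-dec (y ≟ y)) (refl , refl) = refl

  push-backward : ∀ m {x y} → x ≢ y → push m x y y x ≡ suc (m y x)
  push-backward m {x} {y} x≢y
    rewrite dec-false ((y ≟ x) ×-dec (x ≟ y)) (x≢y ∘ sym ∘ proj₁)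
          | dec-true ((y ≟ y) ×-dec (x ≟ x)) (refl , refl) = refl

  push-elsewhere : ∀ m {x y u v} → ¬ (u ≡ x × v ≡ y) → ¬ (u ≡ y × v ≡ x) → push m x y u v ≡ m u v
  push-elsewhere m {x} {y} {u} {v} ¬xy ¬yx
    rewrite dec-false ((u ≟ x) ×-dec (v ≟ y)) ¬xy | dec-false ((u ≟ y) ×-dec (v ≟ x)) ¬yx = refl

  push-mono : ∀ m {x y a b} → b ≢ y → m a b ≤ push m x y a b
  push-mono m {x} {y} {a} {b} b≢y = by-cases ((a ≟ y) ×-dec (b ≟ x))
    where
    by-cases : Dec (a ≡ y × b ≡ x) → m a b ≤ push m x y a b
    by-cases (yes (refl , refl)) = ℕ.≤-trans (ℕ.n≤1+n _) (ℕ.≤-reflexive (sym (push-backward m b≢y)))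
    by-cases (no ¬yx)            = ℕ.≤-reflexive (sym (push-elsewhere m (b≢y ∘ proj₂) ¬yx))

  push-pair : ∀ m {x y} → x ≢ y → 0 < m x y → ∀ u v →
              push m x y u v + push m x y v u ≡ m u v + m v u
  push-pair m {x} {y} x≢y m>0 u v with (u ≟ x) ×-dec (v ≟ y) | (u ≟ y) ×-dec (v ≟ x)
  ... | yes (refl , refl) | _ rewrite push-forward m x y | push-backward m x≢y =
    pred-+-suc (m y x) m>0
  ... | no _ | yes (refl , refl) rewrite push-forward m x y | push-backward m x≢y =
    trans (ℕ.+-comm (suc (m y x)) _) (trans (pred-+-suc (m y x) m>0) (ℕ.+-comm (m x y) _))
  ... | no ¬xy | no ¬yx
    rewrite push-elsewhere m ¬xy ¬yx
          | push-elsewhere m {u = v} {v = u} (λ (v≡x , u≡y) → ¬yx (u≡y , v≡x))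
                                             (λ (v≡y , u≡x) → ¬xy (u≡x , v≡y))
    = refl

  row-push : ∀ m {x y} → x ≢ y → 0 < m x y → ∀ u →
             row (push m x y) u + 𝟙[ u ≡ x ] ≡ row m u + 𝟙[ u ≡ y ]
  row-push m {x} {y} x≢y m>0 u = by-cases (u ≟ x) (u ≟ y)
    where
    by-cases : Dec (u ≡ x) → Dec (u ≡ y) → row (push m x y) u + 𝟙[ u ≡ x ] ≡ row m u + 𝟙[ u ≡ y ]
    by-cases (yes refl) _ rewrite 𝟙-refl u | 𝟙-≢ x≢y =
      +-suc-cancel _ _ (pred (m u y)) (begin
        row (push m u y) u + suc (pred (m u y))
          ≡⟨ cong (row (push m u y) u +_) (ℕ.suc-pred (m u y) {{ℕ.>-nonZero m>0}}) ⟩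
        row (push m u y) u + m u y
          ≡⟨ ΣV-agree-except (push m u y u) (m u) y
               (λ v v≢y → push-elsewhere m (v≢y ∘ proj₂) (x≢y ∘ proj₁)) ⟩
        row m u + push m u y u y
          ≡⟨ cong (row m u +_) (push-forward m u y) ⟩
        row m u + pred (m u y)
          ∎)
    by-cases (no u≢x) (yes refl) rewrite 𝟙-refl u | 𝟙-≢ u≢x =
      sym (+-suc-cancel _ _ (m u x) (begin
        row m u + suc (m u x)     ≡⟨ cong (row m u +_) (push-backward m x≢y) ⟨
        row m u + push m x u u x  ≡⟨ ΣV-agree-except (push m x u u) (m u) x
                                       (λ v v≢x → push-elsewhere m (u≢x ∘ proj₁) (v≢x ∘ proj₂)) ⟨
        row (push m x u) u + m u x  ∎))
    by-cases (no u≢x) (no u≢y) rewrite 𝟙-≢ u≢x | 𝟙-≢ u≢y =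
      cong (_+ 0) (ΣV-cong (λ v → push-elsewhere m {v = v} (u≢x ∘ proj₁) (u≢y ∘ proj₁)))

  Part : Set
  Part = V → Bool

  _⊆ᵖ_ : Part → Part → Set
  R ⊆ᵖ R′ = ∀ v → R v ≡ true → R′ v ≡ true

  -- Each step
  -- enters a vertex outside the part covered by the path so far, so pushing along the
  -- earlier steps never lowers the residual capacity of a later one.
  data Path (m : Matrix) : Part → V → Set where
    start : ∀ {R} → R s ≡ true → Path m R s
    step  : ∀ {R R′ x y} → Path m R x → 0 < m x y → R y ≡ false → R ⊆ᵖ R′ → R′ y ≡ true →
            Path m R′ y

  end∈ : ∀ {m R y} → Path m R y → R y ≡ true
  end∈ (start s∈R)         = s∈R
  end∈ (step _ _ _ _ y∈R′) = y∈R′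

  widen : ∀ {m R R′ y} → Path m R y → R ⊆ᵖ R′ → Path m R′ y
  widen (start s∈R)                R⊆R′ = start (R⊆R′ s s∈R)
  widen (step p m>0 y∉ R⊆R″ y∈R″) R⊆R′ = step p m>0 y∉ (λ v → R⊆R′ v ∘ R⊆R″ v) (R⊆R′ _ y∈R″)

  augment : ∀ {m R y} → Path m R y → Matrix
  augment {m} (start _)                    = m
  augment (step {x = x} {y = y} p _ _ _ _) = push (augment p) x y

  augment-mono-outside : ∀ {m R y} (p : Path m R y) {a b} → R b ≡ false → m a b ≤ augment p a b
  augment-mono-outside (start _) b∉R = ℕ.≤-refl
  augment-mono-outside (step {R = R} p _ _ R⊆R′ y∈R′) {a} {b} b∉R′ =
    ℕ.≤-trans (augment-mono-outside p b∉R)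
              (push-mono (augment p) (λ { refl → contradiction (trans (sym y∈R′) b∉R′) λ () }))
    where
    b∉R : R b ≡ false
    b∉R with R b in b∈R
    ... | true  = contradiction (trans (sym (R⊆R′ b b∈R)) b∉R′) λ ()
    ... | false = refl

  private
    step-positive : ∀ {m R x y} (p : Path m R x) → 0 < m x y → R y ≡ false → 0 < augment p x y
    step-positive p m>0 y∉R = ℕ.<-≤-trans m>0 (augment-mono-outside p y∉R)

    step-≢ : ∀ {m R x y} → Path m R x → R y ≡ false → x ≢ y
    step-≢ p y∉R refl = contradiction (trans (sym (end∈ p)) y∉R) λ ()

  augment-pair : ∀ {m R y} (p : Path m R y) u v → augment p u v + augment p v u ≡ m u v + m v u
  augment-pair (start _)            u v = refl
  augment-pair (step p m>0 y∉R _ _) u v =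
    trans (push-pair (augment p) (step-≢ p y∉R) (step-positive p m>0 y∉R) u v) (augment-pair p u v)

  row-augment : ∀ {m R y} (p : Path m R y) u → row (augment p) u + 𝟙[ u ≡ s ] ≡ row m u + 𝟙[ u ≡ y ]
  row-augment (start _)                                u = refl
  row-augment {m} (step {x = x} {y = y} p m>0 y∉R _ _) u =
    +-telescope (row (push (augment p) x y) u) (row (augment p) u) (row m u)
      (row-push (augment p) (step-≢ p y∉R) (step-positive p m>0 y∉R) u) (row-augment p u)

  record Reachable (m : Matrix) (R : Part) : Set where
    field
      s∈R  : R s ≡ true
      path : ∀ v → R v ≡ true → Path m R v

  Closed : Matrix → Part → Set
  Closed m R = ∀ u v → R u ≡ true → R v ≡ false → m u v ≡ 0

  insert : V → Part → Part
  insert y R v = R v ∨ does (v ≟ y)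

  outside : Part → ℕ
  outside R = ΣV (λ v → if R v then 0 else 1)

  private
    insert-⊇ : ∀ y R → R ⊆ᵖ insert y R
    insert-⊇ y R v v∈R rewrite v∈R = refl

    insert-new : ∀ y R → insert y R y ≡ true
    insert-new y R rewrite dec-true (y ≟ y) refl = ∨-zeroʳ (R y)

    insert-old : ∀ y R {v} → v ≢ y → insert y R v ≡ R v
    insert-old y R {v} v≢y rewrite dec-false (v ≟ y) v≢y = ∨-identityʳ (R v)

  outside-insert : ∀ {y} R → R y ≡ false → outside (insert y R) < outside R
  outside-insert {y} R y∉R = ℕ.≤-reflexive (begin
    suc (outside (insert y R))          ≡⟨ ℕ.+-comm 1 _ ⟩
    outside (insert y R) + 1            ≡⟨ cong (λ b → outside (insert y R) + count b) y∉R ⟨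
    outside (insert y R) + count (R y)  ≡⟨ ΣV-agree-except _ _ y (λ v v≢y → cong count (insert-old y R v≢y)) ⟩
    outside R + count (insert y R y)    ≡⟨ cong (λ b → outside R + count b) (insert-new y R) ⟩
    outside R + 0                       ≡⟨ ℕ.+-identityʳ _ ⟩
    outside R                           ∎)
    where
    count : Bool → ℕ
    count b = if b then 0 else 1

  reachable-insert : ∀ {m R x y} → Reachable m R → R x ≡ true → R y ≡ false → 0 < m x y →
                     Reachable m (insert y R)
  reachable-insert {m} {R} {x} {y} reach x∈R y∉R m>0 = record
    { s∈R  = insert-⊇ y R s (Reachable.s∈R reach)
    ; path = extend
    }
    where
    extend : ∀ v → insert y R v ≡ true → Path m (insert y R) v
    extend v v∈ with R v in v∈R | v ≟ y
    ... | true  | _        = widen (Reachable.path reach v v∈R) (insert-⊇ y R)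
    ... | false | yes refl = step (Reachable.path reach x x∈R) m>0 y∉R (insert-⊇ y R) (insert-new y R)
    ... | false | no _     = contradiction v∈ λ ()

  closure : ∀ m R → Reachable m R → Acc _<_ (outside R) → ∃ λ R′ → Reachable m R′ × Closed m R′
  closure m R reach (acc rec)
    with ∃? (λ x → ∃? (λ y → (R x Bool.≟ true) ×-dec (R y Bool.≟ false) ×-dec (0 <? m x y)))
  ... | yes (x , y , x∈R , y∉R , m>0) =
    closure m (insert y R) (reachable-insert reach x∈R y∉R m>0) (rec (outside-insert R y∉R))
  ... | no ¬leaving = R , reach , λ x y x∈R y∉R →
    ℕ.n≤0⇒n≡0 (ℕ.≮⇒≥ (λ m>0 → ¬leaving (x , y , x∈R , y∉R , m>0)))

  -- m is the residual matrix C − f of a flow f: skew-symmetry of f becomes the pair-sum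
  -- law and conservation of f at the inner vertices becomes row-fixed.
  record IsResidual (C m : Matrix) : Set where
    field
      pair-sum  : ∀ u v → m u v + m v u ≡ C u v + C v u
      row-fixed : ∀ u → u ≢ s → u ≢ t → row m u ≡ row C u

  record SaturatedResidual (C : Matrix) : Set where
    field
      residual   : Matrix
      isResidual : IsResidual C residual
      side       : Part
      s∈side     : side s ≡ true
      t∉side     : side t ≡ false
      closed     : Closed residual side

  private
    initial : Part
    initial v = does (v ≟ s)

    reachable-initial : ∀ m → Reachable m initial
    reachable-initial m = record { s∈R = dec-true (s ≟ s) refl ; path = start-only }
      where
      start-only : ∀ v → initial v ≡ true → Path m initial v
      start-only v v∈ with v ≟ s | v∈
      ... | yes refl | _ = start v∈
      ... | no _     | ()

  augment-residual : ∀ {C m R} → IsResidual C m → (p : Path m R t) → IsResidual C (augment p)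
  augment-residual {C} {m} res p = record
    { pair-sum  = λ u v → trans (augment-pair p u v) (IsResidual.pair-sum res u v)
    ; row-fixed = λ u u≢s u≢t → trans (ℕ.+-cancelʳ-≡ 0 _ _ (begin
        row (augment p) u + 0           ≡⟨ cong (row (augment p) u +_) (𝟙-≢ u≢s) ⟨
        row (augment p) u + 𝟙[ u ≡ s ]  ≡⟨ row-augment p u ⟩
        row m u + 𝟙[ u ≡ t ]            ≡⟨ cong (row m u +_) (𝟙-≢ u≢t) ⟩
        row m u + 0                     ∎)) (IsResidual.row-fixed res u u≢s u≢t)
    }

  row-augment-source : ∀ {m R} (p : Path m R t) → row (augment p) s < row m s
  row-augment-source {m} p = ℕ.≤-reflexive (begin
    suc (row (augment p) s)         ≡⟨ ℕ.+-comm 1 _ ⟩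
    row (augment p) s + 1           ≡⟨ cong (row (augment p) s +_) (𝟙-refl s) ⟨
    row (augment p) s + 𝟙[ s ≡ s ]  ≡⟨ row-augment p s ⟩
    row m s + 𝟙[ s ≡ t ]            ≡⟨ cong (row m s +_) (𝟙-≢ s≢t) ⟩
    row m s + 0                     ≡⟨ ℕ.+-identityʳ _ ⟩
    row m s                         ∎)

  saturate : ∀ C m → IsResidual C m → Acc _<_ (row m s) → SaturatedResidual C
  saturate C m res (acc rec) with closure m initial (reachable-initial m) (<-wellFounded _)
  ... | R , reach , closed with R t in t∈R
  ...   | false = record { residual = m ; isResidual = res ; side = R
                         ; s∈side = Reachable.s∈R reach ; t∉side = t∈R ; closed = closed }
  ...   | true  = saturate C (augment p) (augment-residual res p) (rec (row-augment-source p))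
    where p = Reachable.path reach t t∈R

  ford-fulkerson : ∀ C → SaturatedResidual C
  ford-fulkerson C = saturate C C trivial (<-wellFounded _)
    where
    trivial : IsResidual C C
    trivial = record { pair-sum = λ _ _ → refl ; row-fixed = λ _ _ _ → refl }

  crossing : Matrix → Part → V → V → ℕ
  crossing C R u v = if R u then (if R v then 0 else C u v) else 0

  cut : Matrix → Part → ℕ
  cut C R = ΣV (λ u → ΣV (crossing C R u))

  row≤cut : ∀ C R {u} → R u ≡ true → ΣV (λ v → if R v then 0 else C u v) ≤ cut C R
  row≤cut C R {u} u∈R =
    subst (λ b → ΣV (λ v → if b then (if R v then 0 else C u v) else 0) ≤ cut C R) u∈R
          (entry≤ΣV (λ u → ΣV (crossing C R u)) u)

  column≤cut : ∀ C R {v} → R v ≡ false → ΣV (λ u → if R u then C u v else 0) ≤ cut C R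
  column≤cut C R {v} v∉R = ΣV-mono-≤ (λ u →
    subst (λ b → (if R u then (if b then 0 else C u v) else 0) ≤ ΣV (crossing C R u)) v∉R
          (entry≤ΣV (crossing C R u) v))

  module _ (R : Part) where

    private
      inner : Matrix → V → V → ℕ
      inner A u v = if R u then (if R v then A u v else 0) else 0

    within : Matrix → ℕ
    within A = ΣV (λ u → ΣV (inner A u))

    rowsFrom : Matrix → ℕ
    rowsFrom A = ΣV (λ u → if R u then row A u else 0)

    rowsFrom≡within+cut : ∀ A → rowsFrom A ≡ within A + cut A R
    rowsFrom≡within+cut A =
      trans (ΣV-cong split-row) (ΣV-distrib-+ (λ u → ΣV (inner A u)) (λ u → ΣV (crossing A R u)))
      where
      split : ∀ u v → A u v ≡ (if R v then A u v else 0) + (if R v then 0 else A u v)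
      split u v with R v
      ... | true  = sym (ℕ.+-identityʳ _)
      ... | false = refl
      split-row : ∀ u → (if R u then row A u else 0) ≡ ΣV (inner A u) + ΣV (crossing A R u)
      split-row u with R u
      ... | true  = trans (ΣV-cong (split u))
                          (ΣV-distrib-+ (λ v → if R v then A u v else 0) (λ v → if R v then 0 else A u v))
      ... | false = sym (cong₂ _+_ ΣV-zero ΣV-zero)

    cut-closed : ∀ {m} → Closed m R → cut m R ≡ 0
    cut-closed {m} closed = trans (ΣV-cong (λ u → trans (ΣV-cong (crossing-zero u)) ΣV-zero)) ΣV-zero
      where
      crossing-zero : ∀ u v → crossing m R u v ≡ 0
      crossing-zero u v with R u in u∈R | R v in v∈R
      ... | true  | true  = refl
      ... | true  | false = closed u v u∈R v∈R
      ... | false | _     = refl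

    within-doubled : ∀ A → within A + within A ≡ ΣV (λ u → ΣV (λ v → inner A u v + inner A v u))
    within-doubled A = begin
      within A + within A
        ≡⟨ cong (within A +_) (ΣV-comm (inner A)) ⟩
      within A + ΣV (λ u → ΣV (λ v → inner A v u))
        ≡⟨ ΣV-distrib-+ (λ u → ΣV (inner A u)) (λ u → ΣV (λ v → inner A v u)) ⟨
      ΣV (λ u → ΣV (inner A u) + ΣV (λ v → inner A v u))
        ≡⟨ ΣV-cong (λ u → ΣV-distrib-+ (inner A u) (λ v → inner A v u)) ⟨
      ΣV (λ u → ΣV (λ v → inner A u v + inner A v u))
        ∎

    within-pair : ∀ {C m} → (∀ u v → m u v + m v u ≡ C u v + C v u) → within m ≡ within C
    within-pair {C} {m} pair = halve (begin
      within m + within m                              ≡⟨ within-doubled m ⟩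
      ΣV (λ u → ΣV (λ v → inner m u v + inner m v u))  ≡⟨ ΣV-cong (λ u → ΣV-cong (inner-pair u)) ⟩
      ΣV (λ u → ΣV (λ v → inner C u v + inner C v u))  ≡⟨ within-doubled C ⟨
      within C + within C                              ∎)
      where
      inner-pair : ∀ u v → inner m u v + inner m v u ≡ inner C u v + inner C v u
      inner-pair u v with R u | R v
      ... | true  | true  = pair u v
      ... | true  | false = refl
      ... | false | true  = refl
      ... | false | false = refl
      halve : ∀ {a b} → a + a ≡ b + b → a ≡ b
      halve {a} {b} eq = trans (ℕ.n≡⌊n+n/2⌋ a) (trans (cong ℕ.⌊_/2⌋ eq) (sym (ℕ.n≡⌊n+n/2⌋ b)))

    rowsFrom-residual : ∀ {C m} → R s ≡ true → R t ≡ false → IsResidual C m →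
                        rowsFrom m + row C s ≡ rowsFrom C + row m s
    rowsFrom-residual {C} {m} s∈R t∉R res = begin
      rowsFrom m + row C s
        ≡⟨ cong (λ b → rowsFrom m + (if b then row C s else 0)) s∈R ⟨
      rowsFrom m + (if R s then row C s else 0)
        ≡⟨ ΣV-agree-except (λ u → if R u then row m u else 0) (λ u → if R u then row C u else 0) s agree ⟩
      rowsFrom C + (if R s then row m s else 0)
        ≡⟨ cong (λ b → rowsFrom C + (if b then row m s else 0)) s∈R ⟩
      rowsFrom C + row m s
        ∎
      where
      agree : ∀ v → v ≢ s → (if R v then row m v else 0) ≡ (if R v then row C v else 0)
      agree v v≢s with R v in v∈R
      ... | true  = IsResidual.row-fixed res v v≢s (λ { refl → contradiction (trans (sym v∈R) t∉R) λ () })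
      ... | false = refl

  flow≡cut : ∀ {C} (sat : SaturatedResidual C) →
             let open SaturatedResidual sat in row residual s + cut C side ≡ row C s
  flow≡cut {C} sat = ℕ.+-cancelˡ-≡ (within side C) _ _ (begin
    within side C + (row m s + cut C side)  ≡⟨ x∙yz≈y∙xz (within side C) (row m s) _ ⟩
    row m s + (within side C + cut C side)  ≡⟨ cong (row m s +_) (rowsFrom≡within+cut side C) ⟨
    row m s + rowsFrom side C               ≡⟨ ℕ.+-comm (row m s) _ ⟩
    rowsFrom side C + row m s               ≡⟨ rowsFrom-residual side s∈side t∉side isResidual ⟨
    rowsFrom side m + row C s               ≡⟨ cong (_+ row C s) (rowsFrom≡within+cut side m) ⟩
    within side m + cut m side + row C s    ≡⟨ cong₂ (λ a b → a + b + row C s) within-m≡within-C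
                                                     (cut-closed side closed) ⟩
    within side C + 0 + row C s             ≡⟨ cong (_+ row C s) (ℕ.+-identityʳ _) ⟩
    within side C + row C s                 ∎)
    where
    open SaturatedResidual sat
    m : Matrix
    m = residual
    within-m≡within-C : within side m ≡ within side C
    within-m≡within-C = within-pair side {C} {m} (IsResidual.pair-sum isResidual)

module RationalNetworks where

  open import Algebra.Bundles using (CommutativeRing)
  open import Data.Integer as ℤ using (+_; -[1+_])
  import Data.Integer.Properties as ℤ
  open import Data.List using (List; []; _∷_; tabulate)
  open import Data.List.Properties using (map-tabulate)
  open import Data.Nat as ℕ using (zero; suc; z≤n; s≤s)
  open import Data.Nat.Divisibility using (_∣_; ∣-trans; m∣m*n; n∣m*n)
  import Data.Nat.DivMod as ℕ
  import Data.Nat.Properties as ℕ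
  open import Data.Rational
    using (ℚ; 0ℚ; 1ℚ; mkℚ; _+_; _*_; _-_; -_; _≤_; _<_; _/_; ↥_; ↧ₙ_; toℚᵘ; *≤*; nonNegative; positive)
  import Data.Rational.Properties as ℚ
  open import Data.Rational.Solver using (module +-*-Solver)
  open import Data.Rational.Unnormalised using (mkℚᵘ; *≡*; _≃_)
  import Data.Rational.Unnormalised.Properties as ℚᵘ
  import Data.Vec.Properties as Vec
  open import Relation.Nullary using (yes; no)
  open import Relation.Nullary.Negation using (contradiction)
  open import Algebra.Properties.AbelianGroup ℚ.+-0-abelianGroup using (xyx⁻¹≈y)
  open import Algebra.Properties.CommutativeMonoid.Sum ℕ.+-0-commutativeMonoid using (sum-syntax)
  open import Algebra.Properties.CommutativeMonoid.Sum ℕ.*-1-commutativeMonoid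
    using () renaming (sum to ∏)
  open import Algebra.Properties.Semiring.Mult (CommutativeRing.semiring ℚ.+-*-commutativeRing)
    using (×-homo-+; ×1-homo-*) renaming (_×_ to _×ℚ_)
  open FiniteSums using (∏-divisible; ∏-nonZero; ∑-outside; ∑-inside)
  open +-*-Solver using (solve; _:+_; _:*_; _:-_; :-_; _:=_)

  toℚ : ℕ → ℚ
  toℚ k = k ×ℚ 1ℚ

  toℚ-+ : ∀ a b → toℚ (a ℕ.+ b) ≡ toℚ a + toℚ b
  toℚ-+ = ×-homo-+ 1ℚ

  toℚ-* : ∀ a b → toℚ (a ℕ.* b) ≡ toℚ a * toℚ b
  toℚ-* = ×1-homo-*

  toℚ-+-scaled : ∀ ε a b → toℚ (a ℕ.+ b) * ε ≡ toℚ a * ε + toℚ b * ε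
  toℚ-+-scaled ε a b = trans (cong (_* ε) (toℚ-+ a b)) (ℚ.*-distribʳ-+ ε (toℚ a) (toℚ b))

  toℚ-nonNeg : ∀ k → 0ℚ ≤ toℚ k
  toℚ-nonNeg zero    = ℚ.≤-refl
  toℚ-nonNeg (suc k) = ℚ.+-mono-≤ (ℚ.<⇒≤ (ℚ.positive⁻¹ 1ℚ)) (toℚ-nonNeg k)

  toℚ-mono-≤ : ∀ {a b} → a ℕ.≤ b → toℚ a ≤ toℚ b
  toℚ-mono-≤ {b = b} z≤n = toℚ-nonNeg b
  toℚ-mono-≤ (s≤s a≤b)   = ℚ.+-monoʳ-≤ 1ℚ (toℚ-mono-≤ a≤b)

  toℚ-pos : ∀ d .{{_ : ℕ.NonZero d}} → 0ℚ < toℚ d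
  toℚ-pos (suc d) = ℚ.<-≤-trans (ℚ.positive⁻¹ 1ℚ) (toℚ-mono-≤ {1} {suc d} (s≤s z≤n))

  toℚ-cancel-< : ∀ {a b} → toℚ a < toℚ b → a ℕ.< b
  toℚ-cancel-< {a} {b} lt with a ℕ.<? b
  ... | yes a<b = a<b
  ... | no a≮b  = contradiction (ℚ.<-≤-trans lt (toℚ-mono-≤ (ℕ.≮⇒≥ a≮b))) (ℚ.<-irrefl refl)

  private
    toℚᵘ-toℚ : ∀ k → toℚᵘ (toℚ k) ≃ mkℚᵘ (+ k) 0
    toℚᵘ-toℚ zero    = ℚᵘ.≃-refl
    toℚᵘ-toℚ (suc k) = ℚᵘ.≃-trans (ℚ.toℚᵘ-homo-+ 1ℚ (toℚ k))
      (ℚᵘ.≃-trans (ℚᵘ.+-congʳ (toℚᵘ 1ℚ) (toℚᵘ-toℚ k)) (*≡* cross))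
      where
      cross : (+ 1 ℤ.* + 1 ℤ.+ + k ℤ.* + 1) ℤ.* + 1 ≡ + suc k ℤ.* + (1 ℕ.* 1)
      cross rewrite ℤ.*-identityʳ (+ k) = refl

  toℚ-/ : ∀ a d .{{_ : ℕ.NonZero d}} → toℚ d * (+ a / d) ≡ toℚ a
  toℚ-/ a (suc d) = ℚ.toℚᵘ-injective
    (ℚᵘ.≃-trans (ℚ.toℚᵘ-homo-* (toℚ (suc d)) (+ a / suc d))
    (ℚᵘ.≃-trans (ℚᵘ.*-cong (toℚᵘ-toℚ (suc d)) (ℚ.toℚᵘ-fromℚᵘ (mkℚᵘ (+ a) d)))
    (ℚᵘ.≃-trans (*≡* cross) (ℚᵘ.≃-sym (toℚᵘ-toℚ a)))))
    where
    cross : (+ suc d ℤ.* + a) ℤ.* + 1 ≡ + a ℤ.* + (1 ℕ.* suc d)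
    cross = trans (ℤ.*-identityʳ _)
              (trans (ℤ.*-comm (+ suc d) (+ a)) (cong (λ k → + a ℤ.* + k) (sym (ℕ.*-identityˡ (suc d)))))

  clear-denominator-< : ∀ {ε a b t d} .{{_ : ℕ.NonZero d}} → 0ℚ < ε →
                        toℚ a * ε < (+ t / d) * (toℚ b * ε) → d ℕ.* a ℕ.< t ℕ.* b
  clear-denominator-< {ε} {a} {b} {t} {d} ε>0 a<tb/d =
    toℚ-cancel-< (ℚ.*-cancelʳ-<-nonNeg ε {{nonNegative (ℚ.<⇒≤ ε>0)}} (begin-strict
      toℚ (d ℕ.* a) * ε                  ≡⟨ cong (_* ε) (toℚ-* d a) ⟩
      toℚ d * toℚ a * ε                  ≡⟨ ℚ.*-assoc (toℚ d) (toℚ a) ε ⟩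
      toℚ d * (toℚ a * ε)                <⟨ ℚ.*-monoʳ-<-pos (toℚ d) {{positive (toℚ-pos d)}} a<tb/d ⟩
      toℚ d * ((+ t / d) * (toℚ b * ε))  ≡⟨ solve 4 (λ x y z e → x :* (y :* (z :* e)) := x :* y :* z :* e)
                                                    refl (toℚ d) (+ t / d) (toℚ b) ε ⟩
      toℚ d * (+ t / d) * toℚ b * ε      ≡⟨ cong (λ x → x * toℚ b * ε) (toℚ-/ t d) ⟩
      toℚ t * toℚ b * ε                  ≡⟨ cong (_* ε) (toℚ-* t b) ⟨
      toℚ (t ℕ.* b) * ε                  ∎))
    where open ℚ.≤-Reasoning

  numerator-nonNeg : ∀ {q} → 0ℚ ≤ q → + ℤ.∣ ↥ q ∣ ≡ ↥ q
  numerator-nonNeg {mkℚ (+ _)    _ _} _       = refl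
  numerator-nonNeg {mkℚ -[1+ _ ] _ _} (*≤* ())

  *-denominator : ∀ {q} → 0ℚ ≤ q → q * toℚ (↧ₙ q) ≡ toℚ ℤ.∣ ↥ q ∣
  *-denominator {q} q≥0 = begin
    q * toℚ (↧ₙ q)                     ≡⟨ ℚ.*-comm q _ ⟩
    toℚ (↧ₙ q) * q                     ≡⟨ cong (toℚ (↧ₙ q) *_) (ℚ.↥p/↧p≡p q) ⟨
    toℚ (↧ₙ q) * (↥ q / ↧ₙ q)          ≡⟨ cong (λ i → toℚ (↧ₙ q) * (i / ↧ₙ q)) (numerator-nonNeg q≥0) ⟨
    toℚ (↧ₙ q) * (+ ℤ.∣ ↥ q ∣ / ↧ₙ q)  ≡⟨ toℚ-/ ℤ.∣ ↥ q ∣ (↧ₙ q) ⟩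
    toℚ ℤ.∣ ↥ q ∣                      ∎
    where open ≡-Reasoning

  module Units (D : ℕ) .{{_ : ℕ.NonZero D}} where

    ε : ℚ
    ε = + 1 / D

    ε>0 : 0ℚ < ε
    ε>0 = ℚ.positive⁻¹ ε {{ℚ.normalize-pos 1 D}}

    units : ℚ → ℕ
    units q = ℤ.∣ ↥ q ∣ ℕ.* (D ℕ./ ↧ₙ q)

    units-correct : ∀ {q} → 0ℚ ≤ q → ↧ₙ q ∣ D → q ≡ toℚ (units q) * ε
    units-correct {q} q≥0 ↧q∣D = begin
      q                        ≡⟨ ℚ.*-identityʳ q ⟨
      q * 1ℚ                   ≡⟨ cong (q *_) (toℚ-/ 1 D) ⟨
      q * (toℚ D * ε)          ≡⟨ cong (λ k → q * (toℚ k * ε)) (ℕ.m/n*n≡m ↧q∣D) ⟨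
      q * (toℚ (r ℕ.* d) * ε)  ≡⟨ cong (λ x → q * (x * ε)) (toℚ-* r d) ⟩
      q * (toℚ r * toℚ d * ε)  ≡⟨ solve 4 (λ q x y e → q :* (x :* y :* e) := q :* y :* x :* e)
                                          refl q (toℚ r) (toℚ d) ε ⟩
      q * toℚ d * toℚ r * ε    ≡⟨ cong (λ x → x * toℚ r * ε) (*-denominator q≥0) ⟩
      toℚ a * toℚ r * ε        ≡⟨ cong (_* ε) (toℚ-* a r) ⟨
      toℚ (a ℕ.* r) * ε        ∎
      where
      open ≡-Reasoning
      a d r : ℕ
      a = ℤ.∣ ↥ q ∣
      d = ↧ₙ q
      r = D ℕ./ d

  Σℚ-cong : ∀ {A : Set} (xs : List A) {f g : A → ℚ} → (∀ x → f x ≡ g x) → Σℚ xs f ≡ Σℚ xs g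
  Σℚ-cong []       f≡g = refl
  Σℚ-cong (x ∷ xs) f≡g = cong₂ _+_ (f≡g x) (Σℚ-cong xs f≡g)

  Σℚ-distrib-− : ∀ {A : Set} (xs : List A) (f g : A → ℚ) →
                 Σℚ xs (λ x → f x - g x) ≡ Σℚ xs f - Σℚ xs g
  Σℚ-distrib-− []       f g = refl
  Σℚ-distrib-− (x ∷ xs) f g rewrite Σℚ-distrib-− xs f g =
    solve 4 (λ a b c d → (a :- b) :+ (c :- d) := (a :+ c) :- (b :+ d)) refl (f x) (g x) (Σℚ xs f) (Σℚ xs g)

  Σℚ-tabulate-units : ∀ {A : Set} {m} (ε : ℚ) (h : Fin m → A) (a : A → ℕ) →
                      Σℚ (tabulate h) (λ x → toℚ (a x) * ε) ≡ toℚ (∑[ i < m ] a (h i)) * ε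
  Σℚ-tabulate-units {m = zero}  ε h a = sym (ℚ.*-zeroˡ ε)
  Σℚ-tabulate-units {m = suc m} ε h a =
    trans (cong (λ x → toℚ (a (h zero)) * ε + x) (Σℚ-tabulate-units ε (h ∘ suc) a))
          (sym (toℚ-+-scaled ε (a (h zero)) _))

  scaled-nonNeg : ∀ {ε} → 0ℚ < ε → ∀ k → 0ℚ ≤ toℚ k * ε
  scaled-nonNeg {ε} ε>0 k =
    subst (_≤ toℚ k * ε) (ℚ.*-zeroˡ ε) (ℚ.*-monoʳ-≤-nonNeg ε {{nonNegative (ℚ.<⇒≤ ε>0)}} (toℚ-nonNeg k))

  p-q≤p : ∀ p {q} → 0ℚ ≤ q → p - q ≤ p
  p-q≤p p q≥0 = subst (p - _ ≤_) (ℚ.+-identityʳ p) (ℚ.+-monoʳ-≤ p (ℚ.neg-antimono-≤ q≥0))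

  pair-sum⇒skew : ∀ a b c d → a + b ≡ c + d → c - a ≡ - (d - b)
  pair-sum⇒skew a b c d a+b≡c+d = begin
    c - a                ≡⟨ solve 3 (λ a c d → c :- a := (c :+ d) :+ (:- a :- d)) refl a c d ⟩
    (c + d) + (- a - d)  ≡⟨ cong (_+ (- a - d)) a+b≡c+d ⟨
    (a + b) + (- a - d)  ≡⟨ solve 3 (λ a b d → (a :+ b) :+ (:- a :- d) := :- (d :- b)) refl a b d ⟩
    - (d - b)            ∎
    where open ≡-Reasoning

  vert : ∀ {n} → Fin (2 ℕ.+ n) → Vert n
  vert zero          = σ
  vert (suc zero)    = τ
  vert (suc (suc i)) = old i

  vertex-enumeration : ∀ n → Fin (2 ℕ.+ n) ↔ Vert n
  vertex-enumeration n = mk↔ₛ′ vert index vert-index index-vert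
    where
    index : Vert n → Fin (2 ℕ.+ n)
    index σ       = zero
    index τ       = suc zero
    index (old i) = suc (suc i)
    vert-index : ∀ v → vert (index v) ≡ v
    vert-index σ       = refl
    vert-index τ       = refl
    vert-index (old i) = refl
    index-vert : ∀ i → index (vert i) ≡ i
    index-vert zero          = refl
    index-vert (suc zero)    = refl
    index-vert (suc (suc i)) = refl

  σ≢τ : ∀ {n} → σ {n} ≢ τ
  σ≢τ ()

  allVert≡tabulate : ∀ n → allVert n ≡ tabulate vert
  allVert≡tabulate n = cong (λ vs → σ ∷ τ ∷ vs) (map-tabulate id old)

  module IntegralCapacities {n : ℕ} (c : Vert n → Vert n → ℚ) (C : Vert n → Vert n → ℕ)
                            (ε : ℚ) (ε>0 : 0ℚ < ε) (c≡C·ε : ∀ u v → c u v ≡ toℚ (C u v) * ε) where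

    open ResidualNetworks (vertex-enumeration n) σ τ σ≢τ

    scaled : ℕ → ℚ
    scaled k = toℚ k * ε

    Σℚ-scaled : (a : Vert n → ℕ) → Σℚ (allVert n) (λ v → scaled (a v)) ≡ scaled (ΣV a)
    Σℚ-scaled a = trans (cong (λ vs → Σℚ vs (λ v → scaled (a v))) (allVert≡tabulate n))
                        (Σℚ-tabulate-units ε vert a)

    cutCapacity≡ : ∀ W → cutCapacity c W ≡ scaled (cut C (inSide W))
    cutCapacity≡ W = trans
      (Σℚ-cong (allVert n) (λ u →
        trans (Σℚ-cong (allVert n) (scaled-term u)) (Σℚ-scaled (crossing C (inSide W) u))))
      (Σℚ-scaled (λ u → ΣV (crossing C (inSide W) u)))
      where
      scaled-term : ∀ u v → (if inSide W u then (if inSide W v then 0ℚ else c u v) else 0ℚ) ≡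
                            scaled (crossing C (inSide W) u v)
      scaled-term u v with inSide W u | inSide W v
      ... | true  | true  = sym (ℚ.*-zeroˡ ε)
      ... | true  | false = c≡C·ε u v
      ... | false | _     = sym (ℚ.*-zeroˡ ε)

    residualFlow : Matrix → Vert n → Vert n → ℚ
    residualFlow m u v = scaled (C u v) - scaled (m u v)

    Σℚ-residualFlow : ∀ m u → Σℚ (allVert n) (residualFlow m u) ≡ scaled (row C u) - scaled (row m u)
    Σℚ-residualFlow m u =
      trans (Σℚ-distrib-− (allVert n) (λ v → scaled (C u v)) (λ v → scaled (m u v)))
            (cong₂ _-_ (Σℚ-scaled (C u)) (Σℚ-scaled (m u)))

    residualFlow-isFlow : ∀ {m} → IsResidual C m → IsFlow c (residualFlow m)
    residualFlow-isFlow {m} res = record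
      { skew         = λ u v →
          pair-sum⇒skew (scaled (m u v)) (scaled (m v u)) (scaled (C u v)) (scaled (C v u)) (scaled-pair u v)
      ; capacity     = λ u v →
          subst (residualFlow m u v ≤_) (sym (c≡C·ε u v)) (p-q≤p _ (scaled-nonNeg ε>0 (m u v)))
      ; conservation = λ i → begin
          Σℚ (allVert n) (residualFlow m (old i))          ≡⟨ Σℚ-residualFlow m (old i) ⟩
          scaled (row C (old i)) - scaled (row m (old i))  ≡⟨ cong (λ k → scaled (row C (old i)) - scaled k)
                                                                (row-fixed (old i) (λ ()) (λ ())) ⟩
          scaled (row C (old i)) - scaled (row C (old i))  ≡⟨ ℚ.+-inverseʳ (scaled (row C (old i))) ⟩
          0ℚ                                               ∎
      }
      where
      open ≡-Reasoning
      open IsResidual res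
      scaled-pair : ∀ u v → scaled (m u v) + scaled (m v u) ≡ scaled (C u v) + scaled (C v u)
      scaled-pair u v = begin
        scaled (m u v) + scaled (m v u)  ≡⟨ toℚ-+-scaled ε (m u v) _ ⟨
        scaled (m u v ℕ.+ m v u)         ≡⟨ cong scaled (pair-sum u v) ⟩
        scaled (C u v ℕ.+ C v u)         ≡⟨ toℚ-+-scaled ε (C u v) _ ⟩
        scaled (C u v) + scaled (C v u)  ∎

    residualFlow-value : (sat : SaturatedResidual C) → let open SaturatedResidual sat in
                         flowValue (residualFlow residual) ≡ scaled (cut C side)
    residualFlow-value sat = begin
      flowValue (residualFlow m)
        ≡⟨ Σℚ-residualFlow m σ ⟩
      scaled (row C σ) - scaled (row m σ)
        ≡⟨ cong (λ k → scaled k - scaled (row m σ)) (flow≡cut sat) ⟨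
      scaled (row m σ ℕ.+ cut C side) - scaled (row m σ)
        ≡⟨ cong (_- scaled (row m σ)) (toℚ-+-scaled ε (row m σ) _) ⟩
      scaled (row m σ) + scaled (cut C side) - scaled (row m σ)
        ≡⟨ xyx⁻¹≈y (scaled (row m σ)) _ ⟩
      scaled (cut C side)
        ∎
      where
      open ≡-Reasoning
      open SaturatedResidual sat
      m : Matrix
      m = residual

    minCut≤maxFlow : ∀ {U f} → IsMinCut c U → IsMaxFlow c f → cutCapacity c U ≤ flowValue f
    minCut≤maxFlow {U} {f} U-min f-max = begin
      cutCapacity c U                    ≤⟨ U-min W ⟩
      cutCapacity c W                    ≡⟨ cutCapacity≡ W ⟩
      scaled (cut C (inSide W))          ≡⟨ cong scaled (ΣV-cong (λ u → ΣV-cong (crossing-W u))) ⟩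
      scaled (cut C side)                ≡⟨ residualFlow-value sat ⟨
      flowValue (residualFlow residual)  ≤⟨ IsMaxFlow.maximal f-max _ (residualFlow-isFlow isResidual) ⟩
      flowValue f                        ∎
      where
      open ℚ.≤-Reasoning
      sat : SaturatedResidual C
      sat = ford-fulkerson C
      open SaturatedResidual sat
      W : Subset n
      W = Vec.tabulate (side ∘ old)
      inSide-W : ∀ v → inSide W v ≡ side v
      inSide-W σ       = sym s∈side
      inSide-W τ       = sym t∉side
      inSide-W (old i) = Vec.lookup∘tabulate (side ∘ old) i
      crossing-W : ∀ u v → crossing C (inSide W) u v ≡ crossing C side u v
      crossing-W u v rewrite inSide-W u | inSide-W v = refl

  module TerminalNetwork {n : ℕ} (G : WGraph n) (T S : Subset n) (δκ : ℚ) (δκ>0 : 0ℚ < δκ) where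

    open WGraph G using (w; w-nn)

    weight-denominators : Fin n → ℕ
    weight-denominators i = ∏ (λ j → ↧ₙ (w i j))

    D : ℕ
    D = ↧ₙ δκ ℕ.* ∏ weight-denominators

    instance
      D≢0 : ℕ.NonZero D
      D≢0 = ℕ.m*n≢0 (↧ₙ δκ) _ {{_}}
              {{∏-nonZero weight-denominators (λ i → ∏-nonZero (λ j → ↧ₙ (w i j)) (λ _ → _))}}

    open Units D

    K : ℕ
    K = units δκ

    capℕ : Vert n → Vert n → ℕ
    capℕ σ       (old i) = if lookup S i then K else 0
    capℕ (old i) σ       = if lookup S i then K else 0
    capℕ τ       (old i) = if lookup (T ─ S) i then K else 0
    capℕ (old i) τ       = if lookup (T ─ S) i then K else 0
    capℕ (old i) (old j) = units (w i j)
    capℕ _       _       = 0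

    private
      δκ≡K·ε : δκ ≡ toℚ K * ε
      δκ≡K·ε = units-correct (ℚ.<⇒≤ δκ>0) (m∣m*n _)

      terminal-edge : ∀ b → (if b then δκ else 0ℚ) ≡ toℚ (if b then K else 0) * ε
      terminal-edge true  = δκ≡K·ε
      terminal-edge false = sym (ℚ.*-zeroˡ ε)

    cap'≡capℕ·ε : ∀ u v → cap' G T S δκ u v ≡ toℚ (capℕ u v) * ε
    cap'≡capℕ·ε σ       σ       = sym (ℚ.*-zeroˡ ε)
    cap'≡capℕ·ε σ       τ       = sym (ℚ.*-zeroˡ ε)
    cap'≡capℕ·ε σ       (old i) = terminal-edge (lookup S i)
    cap'≡capℕ·ε τ       σ       = sym (ℚ.*-zeroˡ ε)
    cap'≡capℕ·ε τ       τ       = sym (ℚ.*-zeroˡ ε)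
    cap'≡capℕ·ε τ       (old i) = terminal-edge (lookup (T ─ S) i)
    cap'≡capℕ·ε (old i) σ       = terminal-edge (lookup S i)
    cap'≡capℕ·ε (old i) τ       = terminal-edge (lookup (T ─ S) i)
    cap'≡capℕ·ε (old i) (old j) = units-correct (w-nn i j)
      (∣-trans (∏-divisible (λ j → ↧ₙ (w i j)) j)
               (∣-trans (∏-divisible weight-denominators i) (n∣m*n (↧ₙ δκ))))

    open ResidualNetworks (vertex-enumeration n) σ τ σ≢τ using (cut; row≤cut; column≤cut) public
    open IntegralCapacities (cap' G T S δκ) capℕ ε ε>0 cap'≡capℕ·ε using (cutCapacity≡; minCut≤maxFlow)

    -- Summing over the enumeration σ, τ, old 0, old 1, …, the σ-row and the τ-column of the
    -- cut reduce to 0 + (0 + ∑ᵢ …), which the counting lemmas evaluate.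
    source-edges≤cut : ∀ U → ∣ S ─ U ∣ ℕ.* K ℕ.≤ cut capℕ (inSide U)
    source-edges≤cut U =
      subst (ℕ._≤ cut capℕ (inSide U)) (∑-outside K S U) (row≤cut capℕ (inSide U) {σ} refl)

    sink-edges≤cut : ∀ U → ∣ (T ─ S) ─ ∁ U ∣ ℕ.* K ℕ.≤ cut capℕ (inSide U)
    sink-edges≤cut U =
      subst (ℕ._≤ cut capℕ (inSide U)) (∑-inside K (T ─ S) U) (column≤cut capℕ (inSide U) {τ} refl)

    small-flow⇒small-cut : ∀ {U f} → IsMinCut (cap' G T S δκ) U → IsMaxFlow (cap' G T S δκ) f →
                            flowValue f < (+ ∣ T ∣ / 6) * δκ → 6 ℕ.* cut capℕ (inSide U) ℕ.< ∣ T ∣ ℕ.* K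
    small-flow⇒small-cut {U} {f} U-min f-max small =
      clear-denominator-< {a = cut capℕ (inSide U)} {b = K} {t = ∣ T ∣} {d = 6} ε>0 (begin-strict
        toℚ (cut capℕ (inSide U)) * ε  ≡⟨ cutCapacity≡ U ⟨
        cutCapacity (cap' G T S δκ) U  ≤⟨ minCut≤maxFlow U-min f-max ⟩
        flowValue f                    <⟨ small ⟩
        (+ ∣ T ∣ / 6) * δκ             ≡⟨ cong ((+ ∣ T ∣ / 6) *_) δκ≡K·ε ⟩
        (+ ∣ T ∣ / 6) * (toℚ K * ε)    ∎)
      where open ℚ.≤-Reasoning

open import Data.Nat using (_≤_)
open import Data.Nat as ℕ using ()
open import Data.Rational using (ℚ; 0ℚ; _<_; _*_)
open import Data.Rational as ℚ using ()
open import Data.Integer using (+_)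
import Data.Rational.Properties as ℚ
open RationalNetworks using (module TerminalNetwork)
open SideSizes using (large-side)

lemma4p7 : (n : ℕ) (G : WGraph n) (T S : Subset n) → S ⊆ T →
             (δ κ : ℚ) → 0ℚ < δ → 0ℚ < κ →
             (U : Subset n) → IsMinCut (cap' G T S (δ * κ)) U →
             (f : Vert n → Vert n → ℚ) → IsMaxFlow (cap' G T S (δ * κ)) f →
             ∣ T ∣ ℕ.≤ 3 ℕ.* ∣ S ∣ →
             ∣ T ∣ ℕ.≤ 3 ℕ.* ∣ T ─ S ∣ →
             flowValue f < ((+ ∣ T ∣) ℚ./ 6) * δ * κ →
             (∣ T ∣ ℕ.≤ 6 ℕ.* ∣ U ∣) × (∣ T ∣ ℕ.≤ 6 ℕ.* ∣ ∁ U ∣)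
lemma4p7 n G T S _ δ κ δ>0 κ>0 U U-min f f-max T≤3S T≤3[T─S] small-flow =
    large-side S U T≤3S (source-edges≤cut U) small-cut
  , large-side (T ─ S) (∁ U) T≤3[T─S] (sink-edges≤cut U) small-cut
  where
  δκ>0 : 0ℚ < δ * κ
  δκ>0 = ℚ.positive⁻¹ _ {{ℚ.pos*pos⇒pos δ {{ℚ.positive δ>0}} κ {{ℚ.positive κ>0}}}}
  open TerminalNetwork G T S (δ * κ) δκ>0
  small-cut : 6 ℕ.* cut capℕ (inSide U) ℕ.< ∣ T ∣ ℕ.* K
  small-cut = small-flow⇒small-cut U-min f-max
                (subst (flowValue f <_) (ℚ.*-assoc (+ ∣ T ∣ ℚ./ 6) δ κ) small-flow)
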